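{- For every formula $A$ of MRL, the sequent $\vdash\Omega\{A\}$ is derivable in MRL.
   Context: Fix a set $\Omega$ of roles (possibly infinite). A role set is a subset $R\subseteq\Omega$; $\overline{R}=\Omega\setminus R$; $R_1\uplus\cdots\uplus R_n=\Omega$ means the $R_i$ are pairwise disjoint with union $\Omega$. An ultrafilter on $\Omega$ is a family $\mathcal U$ of subsets of $\Omega$ with $\Omega\in\mathcal U$, closed upward and under binary intersection, and containing $R$ or $\overline R$ for every $R$. For an endomorphism $f:\Omega\to\Omega$, $f^{ -1}(R)=\{r\mid f(r)\in R\}$. Formulas of MRL, over first-order terms $t$ and variables $x$: $A,B::=a\mid\neg_f(A)\mid A\wedge_{\mathcal U}B\mid\forall_{\mathcal U}(\lambda x.A)$ ($a$ primitive formulas, $f$ endomorphisms of $\Omega$, $\mathcal U$ ultrafilters); $A[x:=t]$ is substitution. An i-formula is $R\{A\}$ with $R\subseteq\Omega$; a sequent $\Gamma$ is a finite multiset of i-formulas. Derivable sequents $\vdash\Gamma$ are generated by: (Id) $\vdash R_1\{a\},\ldots,R_n\{a\}$ whenever $R_1\uplus\cdots\uplus R_n=\Omega$; (Weaken) from $\Gamma$ infer $\Gamma,R\{A\}$; (Contract) from $\Gamma,R\{A\},R\{A\}$ infer $\Gamma,R\{A\}$; ($\neg$) from $\Gamma,f^{ -1}(R)\{A\}$ infer $\Gamma,R\{\neg_f(A)\}$; ($\wedge$-neg-l/r) if $R\notin\mathcal U$, from $\Gamma,R\{A\}$ (resp. $\Gamma,R\{B\}$) infer $\Gamma,R\{A\wedge_{\mathcal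 U}B\}$; ($\wedge$-pos) if $R\in\mathcal U$, from $\Gamma,R\{A\}$ and $\Gamma,R\{B\}$ infer $\Gamma,R\{A\wedge_{\mathcal U}B\}$; ($\forall$-neg) if $R\notin\mathcal U$, from $\Gamma,R\{A[x:=t]\}$ infer $\Gamma,R\{\forall_{\mathcal U}(\lambda x.A)\}$; ($\forall$-pos) if $R\in\mathcal U$ and $x$ not free in $\Gamma$, from $\Gamma,R\{A\}$ infer $\Gamma,R\{\forall_{\mathcal U}(\lambda x.A)\}$. -}

module Defs where

open import Data.Nat using (ℕ; zero; suc)
open import Data.Bool using (Bool; true; false; not; _∧_)
open import Data.List using (List; []; _∷_; map; length; lookup)
open import Data.List.Relation.Unary.Any using (Any)
open import Data.List.Relation.Binary.Permutation.Propositional using (_↭_)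
open import Data.Fin using (Fin)
open import Data.Product using (_×_)
open import Data.Sum using (_⊎_)
open import Relation.Binary.PropositionalEquality using (_≡_)
open import Relation.Nullary using (¬_)

-- The logic MRL, parameterised by
--   Ω   : the set of roles (arbitrary, possibly infinite),
--   Fun : function symbols of the first-order term language,
--   Pr  : predicate symbols (primitive formulas are  Pr  applied to terms).
module MRL (Ω : Set) (Fun : Set) (Pr : Set) where

  RoleSet : Set
  RoleSet = Ω → Bool

  _∈ᴿ_ : Ω → RoleSet → Set
  r ∈ᴿ R = R r ≡ true

  full : RoleSet
  full _ = true

  compl : RoleSet → RoleSet
  compl R r = not (R r)

  _∩_ : RoleSet → RoleSet → RoleSet
  (R ∩ S) r = R r ∧ S r

  _⊆_ : RoleSet → RoleSet → Set
  R ⊆ S = ∀ r → r ∈ᴿ R → r ∈ᴿ S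

  preimage : (Ω → Ω) → RoleSet → RoleSet
  preimage f R r = R (f r)

  Partition : List RoleSet → Set
  Partition Rs =
    (∀ r → Any (λ R → r ∈ᴿ R) Rs) ×
    (∀ (i j : Fin (length Rs)) r →
       r ∈ᴿ lookup Rs i → r ∈ᴿ lookup Rs j → i ≡ j)

  record Ultrafilter : Set₁ where
    field
      _∈U : RoleSet → Set
      whole  : full ∈U
      upward : ∀ R S → R ⊆ S → R ∈U → S ∈U
      inter  : ∀ R S → R ∈U → S ∈U → (R ∩ S) ∈U
      total  : ∀ R → R ∈U ⊎ (compl R) ∈U

  open Ultrafilter public

  -- First-order terms (variables as de Bruijn indices)

  data Term : Set where
    var : ℕ → Term
    fn  : Fun → List Term → Term

  mutual
    renT : (ℕ → ℕ) → Term → Term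
    renT ρ (var x)   = var (ρ x)
    renT ρ (fn g ts) = fn g (renTs ρ ts)

    renTs : (ℕ → ℕ) → List Term → List Term
    renTs ρ []       = []
    renTs ρ (t ∷ ts) = renT ρ t ∷ renTs ρ ts

  mutual
    subT : (ℕ → Term) → Term → Term
    subT σ (var x)   = σ x
    subT σ (fn g ts) = fn g (subTs σ ts)

    subTs : (ℕ → Term) → List Term → List Term
    subTs σ []       = []
    subTs σ (t ∷ ts) = subT σ t ∷ subTs σ ts

  liftRen : (ℕ → ℕ) → ℕ → ℕ
  liftRen ρ zero    = zero
  liftRen ρ (suc x) = suc (ρ x)

  liftSub : (ℕ → Term) → ℕ → Term
  liftSub σ zero    = var zero
  liftSub σ (suc x) = renT suc (σ x)

  -- Formulas of MRL
  --   atom p ts        : primitive formula a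
  --   neg f A          : ¬_f(A)
  --   and U A B        : A ∧_U B
  --   all U A          : ∀_U(λx.A)   (x is de Bruijn index 0 in A)

  data Formula : Set₁ where
    atom : Pr → List Term → Formula
    neg  : (Ω → Ω) → Formula → Formula
    and  : Ultrafilter → Formula → Formula → Formula
    all  : Ultrafilter → Formula → Formula

  renF : (ℕ → ℕ) → Formula → Formula
  renF ρ (atom p ts) = atom p (renTs ρ ts)
  renF ρ (neg f A)   = neg f (renF ρ A)
  renF ρ (and U A B) = and U (renF ρ A) (renF ρ B)
  renF ρ (all U A)   = all U (renF (liftRen ρ) A)

  subF : (ℕ → Term) → Formula → Formula
  subF σ (atom p ts) = atom p (subTs σ ts)
  subF σ (neg f A)   = neg f (subF σ A)
  subF σ (and U A B) = and U (subF σ A) (subF σ B)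
  subF σ (all U A)   = all U (subF (liftSub σ) A)

  -- A[x:=t] where x is the variable bound by the enclosing ∀ (index 0)
  inst : Term → ℕ → Term
  inst t zero    = t
  inst t (suc x) = var x

  _[_] : Formula → Term → Formula
  A [ t ] = subF (inst t) A

  -- i-formulas and sequents (multisets, as lists up to permutation)

  record IFormula : Set₁ where
    constructor _⟪_⟫
    field
      role : RoleSet
      form : Formula

  Sequent : Set₁
  Sequent = List IFormula

  -- shifting all free variables of a sequent (to make room for a fresh
  -- eigenvariable, index 0, which is thereby not free in the sequent)
  shiftI : IFormula → IFormula
  shiftI (R ⟪ A ⟫) = R ⟪ renF suc A ⟫

  infix 1 ⊢_

  data ⊢_ : Sequent → Set₁ where
    exch     : ∀ {Γ Δ} → Γ ↭ Δ → ⊢ Γ → ⊢ Δ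
    id       : ∀ (Rs : List RoleSet) p ts → Partition Rs →
               ⊢ map (λ R → R ⟪ atom p ts ⟫) Rs
    weaken   : ∀ {Γ} R A → ⊢ Γ → ⊢ (R ⟪ A ⟫ ∷ Γ)
    contract : ∀ {Γ R A} → ⊢ (R ⟪ A ⟫ ∷ R ⟪ A ⟫ ∷ Γ) → ⊢ (R ⟪ A ⟫ ∷ Γ)
    negR     : ∀ {Γ R f A} → ⊢ (preimage f R ⟪ A ⟫ ∷ Γ) → ⊢ (R ⟪ neg f A ⟫ ∷ Γ)
    and-neg-l : ∀ {Γ R U A} B → ¬ ((U ∈U) R) →
               ⊢ (R ⟪ A ⟫ ∷ Γ) → ⊢ (R ⟪ and U A B ⟫ ∷ Γ)
    and-neg-r : ∀ {Γ R U B} A → ¬ ((U ∈U) R) →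
               ⊢ (R ⟪ B ⟫ ∷ Γ) → ⊢ (R ⟪ and U A B ⟫ ∷ Γ)
    and-pos  : ∀ {Γ R U A B} → (U ∈U) R →
               ⊢ (R ⟪ A ⟫ ∷ Γ) → ⊢ (R ⟪ B ⟫ ∷ Γ) → ⊢ (R ⟪ and U A B ⟫ ∷ Γ)
    all-neg  : ∀ {Γ R U} A (t : Term) → ¬ ((U ∈U) R) →
               ⊢ (R ⟪ A [ t ] ⟫ ∷ Γ) → ⊢ (R ⟪ all U A ⟫ ∷ Γ)
    all-pos  : ∀ {Γ R U A} → (U ∈U) R →
               ⊢ (R ⟪ A ⟫ ∷ map shiftI Γ) → ⊢ (R ⟪ all U A ⟫ ∷ Γ)

-- Induction on A, keeping the role set Ω throughout: Ω partitions itself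
-- (axiom Id with n = 1), Ω belongs to every ultrafilter (so the positive
-- ∧/∀ rules apply), and f⁻¹(Ω) = Ω (so ¬_f leaves the role set unchanged).
module Submission where

open import Defs
open import Data.List using (List; []; _∷_)
open import Data.List.Relation.Unary.Any using (here)
open import Data.Fin using (zero)
open import Data.Product using (_,_)
open import Relation.Binary.PropositionalEquality using (refl)

module FullRole (Ω Fun Pr : Set) where
  open MRL Ω Fun Pr

  full-partition : Partition (full ∷ [])
  full-partition = (λ _ → here refl) , λ { zero zero _ _ _ → refl }

  ⊢full : (A : Formula) → ⊢ (full ⟪ A ⟫ ∷ [])
  ⊢full (atom p ts) = id (full ∷ []) p ts full-partition
  ⊢full (neg f A)   = negR (⊢full A)
  ⊢full (and U A B) = and-pos (whole U) (⊢full A) (⊢full B)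
  ⊢full (all U A)   = all-pos (whole U) (⊢full A)

lemma2 : (Ω Fun Pr : Set) (A : MRL.Formula Ω Fun Pr) →
         MRL.⊢_ Ω Fun Pr (MRL._⟪_⟫ (MRL.full Ω Fun Pr) A ∷ [])
lemma2 = FullRole.⊢full
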